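{- Let $m$ be a positive integer and let $U_m(n)$ denote the number of representations of $n$ as a sum of powers of $2$ (order of parts disregarded) in which each part equal to $1$ takes one of $2m+1$ colors and each part greater than $1$ takes one of $m$ colors. Then $U_m(n)$ is odd for every integer $n\ge 0$.
   Context: Equivalently, $\sum_{n\ge0}U_m(n)x^n=\frac{1}{(1-x)^{m+1}}\prod_{i=0}^{\infty}(1-x^{2^i})^{ -m}$. -}

module Defs where

open import Data.Nat using (ℕ; zero; suc; _+_; _*_; _∸_; _^_; _≤?_)
open import Data.List using (List; []; _∷_; _++_; replicate; concatMap; upTo; map)
open import Data.Nat.ListAction using (sum)
open import Relation.Nullary using (yes; no)

-- Number of multisets of "kinds" (each kind = a coloured part with given size)
-- whose sizes sum to n.
reps : List ℕ → ℕ → ℕ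
reps [] zero = 1
reps [] (suc _) = 0
reps (k ∷ ks) n = sum (map term (upTo (suc n)))
  where
  term : ℕ → ℕ
  term j with j * k ≤? n
  ... | yes _ = reps ks (n ∸ j * k)
  ... | no _  = 0

-- The coloured parts available when representing n: part 1 in 2m+1 colours,
-- and part 2^i (1 ≤ i ≤ n, which covers every power of 2 that is ≤ n) in m colours.
-- (Powers of 2 larger than n can never occur in a representation of n.)
kinds : ℕ → ℕ → List ℕ
kinds m n = replicate (2 * m + 1) 1
         ++ concatMap (λ i → replicate m (2 ^ suc i)) (upTo n)

U : ℕ → ℕ → ℕ
U m n = reps (kinds m n) n

{-# OPTIONS --safe #-}
module Submission where

open import Defs
open import Data.Nat using (ℕ; _≤_; _%_)
open import Relation.Binary.PropositionalEquality using (_≡_)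

open import Data.Nat using (zero; suc; _+_; _*_; _∸_; _^_; _<_; _≤?_; _<?_; z≤n; s≤s; z<s; NonZero; >-nonZero⁻¹)
open import Data.Nat.Properties
open import Data.Nat.DivMod using (%-distribˡ-+; [m+kn]%n≡m%n)
open import Data.Nat.Induction using (<-rec)
open import Data.Nat.ListAction using (sum)
open import Data.Nat.Tactic.RingSolver using (solve-∀)
open import Data.List using ([]; _∷_; _++_; replicate; concatMap; upTo; applyUpTo)
open import Data.List.Properties using (map-cong; map-upTo)
open import Relation.Binary.Bundles using (Setoid)
import Relation.Binary.Reasoning.Setoid as SetoidReasoning
open import Relation.Binary.PropositionalEquality using (_≗_; refl; sym; trans; subst; cong; cong₂; module ≡-Reasoning)
open import Relation.Nullary using (yes; no; contradiction)

-- Modulo 2, (1 - x^k)^2 ≡ 1 - x^(2k), so 1/(1-x^k)^m · 1/(1-x^k)^m ≡ 1/(1-x^(2k))^m.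
-- In the generating function (1-x)^-(2m+1) ∏_{1≤i≤n} (1-x^(2^i))^-m this merges
-- (1-x)^-2m with (1-x^2)^-m into (1-x^4)^-m, that with (1-x^4)^-m, and so on,
-- leaving (1-x)^-1 (1-x^(2^(n+1)))^-m.  Up to degree n this is 1/(1-x), whose
-- coefficients are all 1.

applyUpTo-cong : ∀ {A : Set} {f g : ℕ → A} → f ≗ g → ∀ N → applyUpTo f N ≡ applyUpTo g N
applyUpTo-cong f≗g zero    = refl
applyUpTo-cong f≗g (suc N) = cong₂ _∷_ (f≗g 0) (applyUpTo-cong (λ j → f≗g (suc j)) N)

sum-applyUpTo-vanishing : ∀ (h : ℕ → ℕ) M N → (∀ j → M ≤ j → h j ≡ 0) → M ≤ N →
                          sum (applyUpTo h N) ≡ sum (applyUpTo h M)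
sum-applyUpTo-vanishing h zero    zero    h≡0 _ = refl
sum-applyUpTo-vanishing h zero    (suc N) h≡0 _ =
  cong₂ _+_ (h≡0 0 z≤n) (sum-applyUpTo-vanishing (λ j → h (suc j)) 0 N (λ j _ → h≡0 (suc j) z≤n) z≤n)
sum-applyUpTo-vanishing h (suc M) (suc N) h≡0 (s≤s M≤N) =
  cong (h 0 +_) (sum-applyUpTo-vanishing (λ j → h (suc j)) M N (λ j M≤j → h≡0 (suc j) (s≤s M≤j)) M≤N)

-- Series are functions ℕ → ℕ.  shift d f is x^d · f, and geom k f is
-- f / (1 - x^k) = Σ_j x^(jk) · f, summed over j ≤ n exactly as reps does.
shift : ℕ → (ℕ → ℕ) → ℕ → ℕ
shift d f n with d ≤? n
... | yes _ = f (n ∸ d)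
... | no _  = 0

shift-below : ∀ {d n} f → n < d → shift d f n ≡ 0
shift-below {d} {n} f n<d with d ≤? n
... | yes d≤n = contradiction d≤n (<⇒≱ n<d)
... | no _    = refl

shift-+ : ∀ {k n} d f → k ≤ n → shift (k + d) f n ≡ shift d f (n ∸ k)
shift-+ {k} {n} d f k≤n with k + d ≤? n | d ≤? n ∸ k
... | yes _     | yes _     = cong f (sym (∸-+-assoc n k d))
... | yes k+d≤n | no d≰n∸k  = contradiction (m+n≤o⇒m≤o∸n d (subst (_≤ n) (+-comm k d) k+d≤n)) d≰n∸k
... | no k+d≰n  | yes d≤n∸k = contradiction (subst (k + d ≤_) (m+[n∸m]≡n k≤n) (+-monoʳ-≤ k d≤n∸k)) k+d≰n
... | no _      | no _      = refl

geom : ℕ → (ℕ → ℕ) → ℕ → ℕ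
geom k f n = sum (applyUpTo (λ j → shift (j * k) f n) (suc n))

-- The left-hand side of reps-term≗shift is the local term of reps, which cannot be
-- named; the mutual block lets Agda infer it from its use in reps-∷.
mutual
  reps-∷ : ∀ k ks n → reps (k ∷ ks) n ≡ geom k (reps ks) n
  reps-∷ k ks n = cong sum (trans (map-cong (reps-term≗shift k ks n) (upTo (suc n))) (map-upTo _ (suc n)))

  reps-term≗shift : ∀ k ks n j → _ ≡ shift (j * k) (reps ks) n
  reps-term≗shift k ks n j with j * k ≤? n
  ... | yes _ = refl
  ... | no _  = refl

geom-below : ∀ {k n} f → n < k → geom k f n ≡ f n
geom-below {k} {n} f n<k = trans (cong (f n +_) tail≡0) (+-identityʳ (f n))
  where
  tail≡0 : sum (applyUpTo (λ j → shift (k + j * k) f n) n) ≡ 0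
  tail≡0 = sum-applyUpTo-vanishing _ 0 n (λ j _ → shift-below f (<-≤-trans n<k (m≤m+n k (j * k)))) z≤n

geom-above : ∀ {k n} .{{_ : NonZero k}} f → k ≤ n → geom k f n ≡ f n + geom k f (n ∸ k)
geom-above {k} {n} f k≤n = cong (f n +_) (begin
  sum (applyUpTo (λ j → shift (k + j * k) f n) n)         ≡⟨ cong sum (applyUpTo-cong (λ j → shift-+ (j * k) f k≤n) n) ⟩
  sum (applyUpTo (λ j → shift (j * k) f (n ∸ k)) n)       ≡⟨ sum-applyUpTo-vanishing _ (suc (n ∸ k)) n beyond (∸-monoʳ-< (>-nonZero⁻¹ k) k≤n) ⟩
  sum (applyUpTo (λ j → shift (j * k) f (n ∸ k)) (suc (n ∸ k))) ∎)
  where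
  open ≡-Reasoning
  beyond : ∀ j → suc (n ∸ k) ≤ j → shift (j * k) f (n ∸ k) ≡ 0
  beyond j n∸k<j = shift-below f (<-≤-trans n∸k<j (m≤m*n j k))

infix 4 _≈₂_
record _≈₂_ (f g : ℕ → ℕ) : Set where
  constructor mk≈₂
  field at : ∀ n → f n % 2 ≡ g n % 2
open _≈₂_

≈₂-setoid : Setoid _ _
≈₂-setoid = record
  { Carrier       = ℕ → ℕ
  ; _≈_           = _≈₂_
  ; isEquivalence = record
    { refl  = mk≈₂ λ n → refl
    ; sym   = λ f≈g → mk≈₂ λ n → sym (at f≈g n)
    ; trans = λ f≈g g≈h → mk≈₂ λ n → trans (at f≈g n) (at g≈h n)
    }
  }

open Setoid ≈₂-setoid using () renaming (refl to ≈₂-refl; trans to ≈₂-trans)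

%-cong-+ : ∀ {d} .{{_ : NonZero d}} a a′ {b b′} → a % d ≡ a′ % d → b % d ≡ b′ % d →
           (a + b) % d ≡ (a′ + b′) % d
%-cong-+ {d} a a′ {b} {b′} a≡a′ b≡b′ = begin
  (a + b) % d               ≡⟨ %-distribˡ-+ a b d ⟩
  (a % d + b % d) % d       ≡⟨ cong (_% d) (cong₂ _+_ a≡a′ b≡b′) ⟩
  (a′ % d + b′ % d) % d     ≡⟨ %-distribˡ-+ a′ b′ d ⟨
  (a′ + b′) % d             ∎
  where open ≡-Reasoning

[m+n]+n%2≡m%2 : ∀ m n → (m + n + n) % 2 ≡ m % 2
[m+n]+n%2≡m%2 m n = trans (cong (_% 2) (regroup m n)) ([m+kn]%n≡m%n m n 2)
  where
  regroup : ∀ m n → m + n + n ≡ m + n * 2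
  regroup = solve-∀

[m+n]+[n+o]%2≡[m+o]%2 : ∀ m n o → (m + n + (n + o)) % 2 ≡ (m + o) % 2
[m+n]+[n+o]%2≡[m+o]%2 m n o = trans (cong (_% 2) (regroup m n o)) ([m+kn]%n≡m%n (m + o) n 2)
  where
  regroup : ∀ m n o → m + n + (n + o) ≡ m + o + n * 2
  regroup = solve-∀

geom-unique : ∀ k .{{_ : NonZero k}} f h →
              (∀ {n} → n < k → h n % 2 ≡ f n % 2) →
              (∀ {n} → k ≤ n → h n % 2 ≡ (f n + h (n ∸ k)) % 2) →
              h ≈₂ geom k f
geom-unique k f h below above = mk≈₂ (<-rec _ step)
  where
  open ≡-Reasoning
  step : ∀ n → (∀ {m} → m < n → h m % 2 ≡ geom k f m % 2) → h n % 2 ≡ geom k f n % 2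
  step n ih with n <? k
  ... | yes n<k = trans (below n<k) (cong (_% 2) (sym (geom-below f n<k)))
  ... | no n≮k  = begin
    h n % 2                       ≡⟨ above k≤n ⟩
    (f n + h (n ∸ k)) % 2         ≡⟨ %-cong-+ (f n) (f n) refl (ih (∸-monoʳ-< (>-nonZero⁻¹ k) k≤n)) ⟩
    (f n + geom k f (n ∸ k)) % 2  ≡⟨ cong (_% 2) (geom-above f k≤n) ⟨
    geom k f n % 2                ∎
    where k≤n = ≮⇒≥ n≮k

geom-resp-≈₂ : ∀ k .{{_ : NonZero k}} {f g} → f ≈₂ g → geom k f ≈₂ geom k g
geom-resp-≈₂ k {f} {g} f≈g = geom-unique k g (geom k f)
  (λ {n} n<k → trans (cong (_% 2) (geom-below f n<k)) (at f≈g n))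
  (λ {n} k≤n → trans (cong (_% 2) (geom-above f k≤n)) (%-cong-+ (f n) (g n) (at f≈g n) refl))

geom-geom : ∀ k .{{_ : NonZero k}} f → geom k (geom k f) ≈₂ geom (2 * k) f
-- h = g + x^k·h = f + 2·x^k·g + x^(2k)·h, so mod 2 h solves the recurrence of f / (1 - x^(2k)).
geom-geom k f = geom-unique (2 * k) {{m*n≢0 2 k}} f (geom k (geom k f)) below above
  where
  open ≡-Reasoning
  g = geom k f
  h = geom k g
  2k≡k+k : 2 * k ≡ k + k
  2k≡k+k = cong (k +_) (+-identityʳ k)
  below : ∀ {n} → n < 2 * k → h n % 2 ≡ f n % 2
  below {n} n<2k with n <? k
  ... | yes n<k = cong (_% 2) (trans (geom-below g n<k) (geom-below f n<k))
  ... | no n≮k  = begin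
    h n % 2                            ≡⟨ cong (_% 2) (geom-above g k≤n) ⟩
    (g n + h (n ∸ k)) % 2              ≡⟨ cong (_% 2) (cong₂ _+_ (geom-above f k≤n) (geom-below g n∸k<k)) ⟩
    (f n + g (n ∸ k) + g (n ∸ k)) % 2  ≡⟨ [m+n]+n%2≡m%2 (f n) (g (n ∸ k)) ⟩
    f n % 2                            ∎
    where
    k≤n = ≮⇒≥ n≮k
    n∸k<k = m<n+o⇒m∸n<o n k (subst (n <_) 2k≡k+k n<2k)
  above : ∀ {n} → 2 * k ≤ n → h n % 2 ≡ (f n + h (n ∸ 2 * k)) % 2
  above {n} 2k≤n = begin
    h n % 2                                        ≡⟨ cong (_% 2) (geom-above g k≤n) ⟩
    (g n + h (n ∸ k)) % 2                          ≡⟨ cong (_% 2) (cong₂ _+_ (geom-above f k≤n) (geom-above g k≤n∸k)) ⟩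
    (f n + g (n ∸ k) + (g (n ∸ k) + h (n ∸ k ∸ k))) % 2  ≡⟨ [m+n]+[n+o]%2≡[m+o]%2 (f n) (g (n ∸ k)) (h (n ∸ k ∸ k)) ⟩
    (f n + h (n ∸ k ∸ k)) % 2                      ≡⟨ cong (λ m → (f n + h m) % 2) (trans (∸-+-assoc n k k) (cong (n ∸_) (sym 2k≡k+k))) ⟩
    (f n + h (n ∸ 2 * k)) % 2                      ∎
    where
    k+k≤n = subst (_≤ n) 2k≡k+k 2k≤n
    k≤n = m+n≤o⇒m≤o k k+k≤n
    k≤n∸k = m+n≤o⇒m≤o∸n k k+k≤n

geom^ : ℕ → ℕ → (ℕ → ℕ) → ℕ → ℕ
geom^ k zero    f = f
geom^ k (suc m) f = geom k (geom^ k m f)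

geom^-+ : ∀ k a b f → geom^ k (a + b) f ≡ geom^ k a (geom^ k b f)
geom^-+ k zero    b f = refl
geom^-+ k (suc a) b f = cong (geom k) (geom^-+ k a b f)

geom^-geom : ∀ k m f → geom^ k m (geom k f) ≡ geom k (geom^ k m f)
geom^-geom k zero    f = refl
geom^-geom k (suc m) f = cong (geom k) (geom^-geom k m f)

geom^-below : ∀ {k n} m f → n < k → geom^ k m f n ≡ f n
geom^-below zero    f n<k = refl
geom^-below (suc m) f n<k = trans (geom-below _ n<k) (geom^-below m f n<k)

geom^-resp-≈₂ : ∀ k .{{_ : NonZero k}} m {f g} → f ≈₂ g → geom^ k m f ≈₂ geom^ k m g
geom^-resp-≈₂ k zero    f≈g = f≈g
geom^-resp-≈₂ k (suc m) f≈g = geom-resp-≈₂ k (geom^-resp-≈₂ k m f≈g)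

geom^-geom^ : ∀ k .{{_ : NonZero k}} m f → geom^ k m (geom^ k m f) ≈₂ geom^ (2 * k) m f
geom^-geom^ k zero    f = ≈₂-refl
geom^-geom^ k (suc m) f = begin
  geom k (geom^ k m (geom k (geom^ k m f)))   ≡⟨ cong (geom k) (geom^-geom k m _) ⟩
  geom k (geom k (geom^ k m (geom^ k m f)))   ≈⟨ geom-resp-≈₂ k (geom-resp-≈₂ k (geom^-geom^ k m f)) ⟩
  geom k (geom k (geom^ (2 * k) m f))         ≈⟨ geom-geom k _ ⟩
  geom (2 * k) (geom^ (2 * k) m f)            ∎
  where open SetoidReasoning ≈₂-setoid

reps-replicate : ∀ k .{{_ : NonZero k}} m ks → reps (replicate m k ++ ks) ≈₂ geom^ k m (reps ks)
reps-replicate k zero    ks = ≈₂-refl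
reps-replicate k (suc m) ks =
  ≈₂-trans (mk≈₂ λ n → cong (_% 2) (reps-∷ k (replicate m k ++ ks) n))
           (geom-resp-≈₂ k (reps-replicate k m ks))

geom^-reps-powersOfTwo : ∀ m c (g : ℕ → ℕ) → (∀ j → g (suc j) ≡ suc (g j)) →
            geom^ (2 ^ suc (g 0)) m (reps (concatMap (λ i → replicate m (2 ^ suc i)) (applyUpTo g c)))
              ≈₂ geom^ (2 ^ suc (g c)) m (reps [])
geom^-reps-powersOfTwo m zero    g g-suc = ≈₂-refl
geom^-reps-powersOfTwo m (suc c) g g-suc = begin
  geom^ K m (reps (replicate m K ++ rest))   ≈⟨ geom^-resp-≈₂ K m (reps-replicate K m rest) ⟩
  geom^ K m (geom^ K m (reps rest))          ≈⟨ geom^-geom^ K m (reps rest) ⟩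
  geom^ (2 * K) m (reps rest)                ≡⟨ cong (λ e → geom^ (2 ^ suc e) m (reps rest)) (sym (g-suc 0)) ⟩
  geom^ (2 ^ suc (g 1)) m (reps rest)        ≈⟨ geom^-reps-powersOfTwo m c (λ j → g (suc j)) (λ j → g-suc (suc j)) ⟩
  geom^ (2 ^ suc (g (suc c))) m (reps [])    ∎
  where
  open SetoidReasoning ≈₂-setoid
  K = 2 ^ suc (g 0)
  instance
    K≢0 : NonZero K
    K≢0 = m^n≢0 2 (suc (g 0))
  rest = concatMap (λ i → replicate m (2 ^ suc i)) (applyUpTo (λ j → g (suc j)) c)

reps-kinds-≈₂ : ∀ m n → reps (kinds m n) ≈₂ geom 1 (geom^ (2 ^ suc n) m (reps []))
reps-kinds-≈₂ m n = begin
  reps (replicate (2 * m + 1) 1 ++ L)   ≈⟨ reps-replicate 1 (2 * m + 1) L ⟩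
  geom^ 1 (2 * m + 1) (reps L)          ≡⟨ cong (λ e → geom^ 1 e (reps L)) 2m+1≡1+[m+m] ⟩
  geom 1 (geom^ 1 (m + m) (reps L))     ≡⟨ cong (geom 1) (geom^-+ 1 m m (reps L)) ⟩
  geom 1 (geom^ 1 m (geom^ 1 m (reps L))) ≈⟨ geom-resp-≈₂ 1 (geom^-geom^ 1 m (reps L)) ⟩
  geom 1 (geom^ 2 m (reps L))           ≈⟨ geom-resp-≈₂ 1 (geom^-reps-powersOfTwo m n (λ i → i) (λ j → refl)) ⟩
  geom 1 (geom^ (2 ^ suc n) m (reps [])) ∎
  where
  open SetoidReasoning ≈₂-setoid
  L = concatMap (λ i → replicate m (2 ^ suc i)) (upTo n)
  2m+1≡1+[m+m] : 2 * m + 1 ≡ 1 + (m + m)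
  2m+1≡1+[m+m] = trans (+-comm (2 * m) 1) (cong (λ e → suc (m + e)) (+-identityʳ m))

geom-1-unit : ∀ f n → (∀ {j} → j ≤ n → f j ≡ reps [] j) → geom 1 f n ≡ 1
geom-1-unit f zero    f≡unit = trans (geom-below {1} f z<s) (f≡unit z≤n)
geom-1-unit f (suc n) f≡unit = trans (geom-above f (s≤s (z≤n {n})))
  (cong₂ _+_ (f≡unit ≤-refl) (geom-1-unit f n (λ j≤n → f≡unit (m≤n⇒m≤1+n j≤n))))

n<2^n : ∀ n → n < 2 ^ n
n<2^n zero    = s≤s z≤n
n<2^n (suc n) = +-mono-≤-< (m^n>0 2 n) (<-≤-trans (n<2^n n) (m≤m+n (2 ^ n) 0))

corollary2p10 : (m : ℕ) → 1 ≤ m → (n : ℕ) → U m n % 2 ≡ 1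
corollary2p10 m _ n = begin
  U m n % 2      ≡⟨ at (reps-kinds-≈₂ m n) n ⟩
  geom 1 Z n % 2 ≡⟨ cong (_% 2) (geom-1-unit Z n (λ j≤n → geom^-below m (reps []) (j<2^[1+n] j≤n))) ⟩
  1              ∎
  where
  open ≡-Reasoning
  Z = geom^ (2 ^ suc n) m (reps [])
  j<2^[1+n] : ∀ {j} → j ≤ n → j < 2 ^ suc n
  j<2^[1+n] j≤n = <-trans (s≤s j≤n) (n<2^n (suc n))
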